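{- Let $n\ge2$ and $1\le m\le\binom{n}{2}$, and let $C(n,m)$ be the colex graph. Then the intervals $[A\setminus Int(A);A\cup Ext(A)]$, $A$ ranging over the maximal independent sets of $C(n,m)$, form a partition of $2^{[n]}$.
   Context: For finite $A,B\subset\mathbb{N}$, $A$ precedes $B$ in colexicographic order if $\max(A\triangle B)\in B$. The colex graph $C(n,m)$ has vertex set $[n]=\{1,\ldots,n\}$ and edge set the first $m$ elements of $\binom{[n]}{2}$ in colexicographic order (i.e. $\{1,2\},\{1,3\},\{2,3\},\{1,4\},\{2,4\},\{3,4\},\{1,5\},\ldots$). Labels give the linear order on vertices. For an independent set $A$: $Ext(A)=\{u\notin A:\ \exists a\in A,\ a\in N(u),\ u>a\}$; for $u\in A$, $Subs(u)=\{w\in N(u): (A\setminus\{u\})\cup\{w\}\text{ independent}\}$, $u$ is internally active if $Subs(u)=\emptyset$ or $u>\max Subs(u)$; $Int(A)$ is the set of internally active vertices of $A$. $[X;Y]=\{Z: X\subseteq Z\subseteq Y\}$. A family of intervals forms a partition if the intervals (for distinct maximal independent sets) are pairwise disjoint and their union is the whole power set. -}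

module Defs where

open import Data.Nat using (ℕ; _<_; _+_)
open import Data.Nat.Combinatorics using (_C_)
open import Data.Fin using (Fin; toℕ)
open import Data.Fin.Subset using (Subset; _∈_; _∉_; _⊆_)
open import Data.Product using (_×_; ∃-syntax)
open import Data.Sum using (_⊎_)
open import Relation.Nullary using (¬_)
open import Relation.Binary.PropositionalEquality using (_≡_)

-- Vertex labelled k (1 ≤ k ≤ n) in the paper is  Fin n  element with toℕ = k - 1;
-- the linear order on vertices is the order of toℕ.

-- Colex order of pairs {a,b}, a < b (1-indexed): the pair {i,j}, i<j, is the
-- (C(j-1,2) + i)-th pair.  With 0-indexed a = i-1, b = j-1 this is  b C 2 + a + 1.
-- The edge {a,b} (a < b, 0-indexed) belongs to C(n,m) iff its position is ≤ m.
ColexEdge : ℕ → ℕ → ℕ → Set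
ColexEdge m a b = (a < b) × (b C 2 + a < m)

Adj : (n m : ℕ) → Fin n → Fin n → Set
Adj n m u v = ColexEdge m (toℕ u) (toℕ v) ⊎ ColexEdge m (toℕ v) (toℕ u)

Independent : (n m : ℕ) → Subset n → Set
Independent n m A = ∀ u v → u ∈ A → v ∈ A → ¬ Adj n m u v

MaximalIndependent : (n m : ℕ) → Subset n → Set
MaximalIndependent n m A =
  Independent n m A × (∀ B → Independent n m B → A ⊆ B → B ⊆ A)

InExt : (n m : ℕ) → Subset n → Fin n → Set
InExt n m A u = u ∉ A × (∃[ a ] (a ∈ A × Adj n m u a × toℕ a < toℕ u))

-- w ∈ Subs(u) w.r.t. A : w ∈ N(u) and (A ∖ {u}) ∪ {w} is independent
-- (membership in (A ∖ {u}) ∪ {w} written out pointwise)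
InSubs : (n m : ℕ) → Subset n → Fin n → Fin n → Set
InSubs n m A u w =
  Adj n m u w ×
  (∀ x y → ((x ∈ A × ¬ x ≡ u) ⊎ x ≡ w) → ((y ∈ A × ¬ y ≡ u) ⊎ y ≡ w) → ¬ Adj n m x y)

-- u ∈ Int(A): u ∈ A and (Subs(u) = ∅ or u > max Subs(u)),
-- i.e. every element of Subs(u) is smaller than u
InInt : (n m : ℕ) → Subset n → Fin n → Set
InInt n m A u = u ∈ A × (∀ w → InSubs n m A u w → toℕ w < toℕ u)

InInterval : (n m : ℕ) → Subset n → Subset n → Set
InInterval n m A Z =
  (∀ v → v ∈ A → ¬ InInt n m A v → v ∈ Z) ×
  (∀ v → v ∈ Z → v ∈ A ⊎ InExt n m A v)

IntervalsPartition : (n m : ℕ) → Set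
IntervalsPartition n m =
  (∀ Z → ∃[ A ] (MaximalIndependent n m A × InInterval n m A Z)) ×
  (∀ A B Z → MaximalIndependent n m A → MaximalIndependent n m B →
     InInterval n m A Z → InInterval n m B Z → A ≡ B)

-- Write m = C(k+1,2) + r with r ≤ k (vertices 0-indexed). Then C(n,m) is a clique on the vertices
-- 0,…,k, the hub k+1 is joined exactly to 0,…,r-1, and all later vertices are isolated. A maximal
-- independent set therefore consists of one clique vertex c, all isolated vertices, and the hub iff
-- r ≤ c. Every vertex of such a set except a clique vertex c < k is internally active (c can be
-- swapped for the larger vertex k), and the clique vertex c is the only possible external witness
-- of a clique vertex. Hence Z lies in the interval of the set with clique vertex c exactly when c is
-- the least clique vertex of Z, or Z misses the clique and c = k: the pivot of Z, which is unique.
module Submission where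

open import Data.Empty using (⊥-elim)
open import Data.Fin using (Fin; toℕ; fromℕ<)
open import Data.Fin.Properties
  using (toℕ-injective; toℕ-fromℕ<; toℕ-inject; any?; ¬∀⟶∃¬-smallest)
  renaming (_≟_ to _≟ᶠ_)
open import Data.Fin.Subset using (Subset; _∈_; _⊆_; _∪_; ⁅_⁆)
open import Data.Fin.Subset.Properties using (_∈?_; x∈p∪q⁻; x∈p∪q⁺; x∈⁅x⁆; x∈⁅y⁆⇒x≡y; ⊆-antisym)
open import Data.Nat using (ℕ; suc; _+_; _≤_; _<_; _≤′_; ≤′-refl; ≤′-step; z≤n; s≤s)
open import Data.Nat.Combinatorics using (_C_; nC1≡n; nCk+nC[k+1]≡[n+1]C[k+1])
open import Data.Nat.Properties
open import Data.Product using (_×_; _,_; ∃; ∃₂; proj₁)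
open import Data.Sum using (_⊎_; inj₁; inj₂)
open import Data.Vec using (tabulate)
open import Data.Vec.Properties using (lookup∘tabulate; lookup⇒[]=; []=⇒lookup)
open import Defs
open import Function using (_∘_)
open import Relation.Binary.Definitions using (tri<; tri≈; tri>)
open import Relation.Binary.PropositionalEquality
open import Relation.Nullary using (¬_; yes; no; does; ¬?)
open import Relation.Nullary.Decidable using (dec-true; decidable-stable; _×-dec_; _⊎-dec_)
open import Relation.Unary using (Pred; Decidable)

C₂-suc : ∀ b → suc b C 2 ≡ b + b C 2
C₂-suc b = trans (sym (nCk+nC[k+1]≡[n+1]C[k+1] b 1)) (cong (_+ b C 2) (nC1≡n b))

C₂-+-< : ∀ {a b} → a < b → b C 2 + a < suc b C 2
C₂-+-< {a} {b} a<b = begin-strict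
  b C 2 + a <⟨ +-monoʳ-< (b C 2) a<b ⟩
  b C 2 + b ≡⟨ +-comm (b C 2) b ⟩
  b + b C 2 ≡⟨ C₂-suc b ⟨
  suc b C 2 ∎
  where open ≤-Reasoning

C₂-mono-≤ : ∀ {a b} → a ≤ b → a C 2 ≤ b C 2
C₂-mono-≤ = mono ∘ ≤⇒≤′
  where
  mono : ∀ {a b} → a ≤′ b → a C 2 ≤ b C 2
  mono ≤′-refl = ≤-refl
  mono {b = suc b} (≤′-step a≤b) =
    ≤-trans (mono a≤b) (subst (b C 2 ≤_) (sym (C₂-suc b)) (m≤n+m (b C 2) b))

C₂-cancel-< : ∀ {a b} → a C 2 < b C 2 → a < b
C₂-cancel-< lt = ≰⇒> (<⇒≱ lt ∘ C₂-mono-≤)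

colex-decomposition : ∀ m → ∃₂ λ k r → r ≤ k × m ≡ suc k C 2 + r
colex-decomposition 0 = 0 , 0 , ≤-refl , refl
colex-decomposition (suc m) with colex-decomposition m
... | k , r , r≤k , m≡ with m≤n⇒m<n∨m≡n r≤k
... | inj₁ r<k = k , suc r , r<k , trans (cong suc m≡) (sym (+-suc _ r))
... | inj₂ refl = suc k , 0 , z≤n , (begin
  suc m               ≡⟨ cong suc m≡ ⟩
  suc (suc k C 2 + k) ≡⟨ +-suc (suc k C 2) k ⟨
  suc k C 2 + suc k   ≡⟨ +-comm (suc k C 2) (suc k) ⟩
  suc k + suc k C 2   ≡⟨ C₂-suc (suc k) ⟨
  suc (suc k) C 2     ≡⟨ +-identityʳ _ ⟨
  suc (suc k) C 2 + 0 ∎)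
  where open ≡-Reasoning

module ColexEdges (m k r : ℕ) (m≡ : m ≡ suc k C 2 + r) (r≤k : r ≤ k) where

  colexEdge-clique : ∀ {a b} → a < b → b ≤ k → ColexEdge m a b
  colexEdge-clique {a} {b} a<b b≤k = a<b , (begin-strict
    b C 2 + a     <⟨ C₂-+-< a<b ⟩
    suc b C 2     ≤⟨ C₂-mono-≤ (s≤s b≤k) ⟩
    suc k C 2     ≤⟨ m≤m+n (suc k C 2) r ⟩
    suc k C 2 + r ≡⟨ m≡ ⟨
    m             ∎)
    where open ≤-Reasoning

  colexEdge-hub : ∀ {a} → a < r → ColexEdge m a (suc k)
  colexEdge-hub a<r = <-≤-trans a<r (m≤n⇒m≤1+n r≤k) , subst (_ <_) (sym m≡) (+-monoʳ-< _ a<r)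

  colexEdge-inv : ∀ {a b} → ColexEdge m a b → a < b × (b ≤ k ⊎ (b ≡ suc k × a < r))
  colexEdge-inv {a} {b} (a<b , lt) with <-cmp b (suc k)
  ... | tri< b<k _ _ = a<b , inj₁ (≤-pred b<k)
  ... | tri≈ _ refl _ = a<b , inj₂ (refl , +-cancelˡ-< _ a r (subst (_ <_) m≡ lt))
  ... | tri> _ _ k<b = ⊥-elim (<-irrefl refl (C₂-cancel-< {suc (suc k)} (begin-strict
    suc (suc k) C 2   ≤⟨ C₂-mono-≤ k<b ⟩
    b C 2             ≤⟨ m≤m+n (b C 2) a ⟩
    b C 2 + a         <⟨ lt ⟩
    m                 ≡⟨ m≡ ⟩
    suc k C 2 + r     ≤⟨ +-monoʳ-≤ _ r≤k ⟩
    suc k C 2 + k     <⟨ C₂-+-< (n<1+n k) ⟩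
    suc (suc k) C 2   ∎)))
    where open ≤-Reasoning

module _ {n : ℕ} where

  ⟦_⟧ : ∀ {ℓ} {P : Pred (Fin n) ℓ} → Decidable P → Subset n
  ⟦ P? ⟧ = tabulate (does ∘ P?)

  ∈⟦⟧⁺ : ∀ {ℓ} {P : Pred (Fin n) ℓ} (P? : Decidable P) {v} → P v → v ∈ ⟦ P? ⟧
  ∈⟦⟧⁺ P? {v} p = lookup⇒[]= v _ (trans (lookup∘tabulate _ v) (dec-true (P? v) p))

  ∈⟦⟧⁻ : ∀ {ℓ} {P : Pred (Fin n) ℓ} (P? : Decidable P) {v} → v ∈ ⟦ P? ⟧ → P v
  ∈⟦⟧⁻ P? {v} v∈ with P? v | trans (sym ([]=⇒lookup v∈)) (lookup∘tabulate _ v)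
  ... | yes p | _ = p
  ... | no _ | ()

  least-witness : ∀ {ℓ} {P : Pred (Fin n) ℓ} → Decidable P → ∃ P →
                  ∃ λ i → P i × (∀ j → P j → toℕ i ≤ toℕ j)
  least-witness {P = P} P? (x , px)
    with ¬∀⟶∃¬-smallest n (¬_ ∘ P) (¬? ∘ P?) (λ ∀¬P → ∀¬P x px)
  ... | i , ¬¬pi , below = i , decidable-stable (P? i) ¬¬pi , λ j pj → ≮⇒≥ λ j<i →
    below (fromℕ< j<i) (subst P (toℕ-injective (sym (trans (toℕ-inject _) (toℕ-fromℕ< j<i)))) pj)

module _ {n m : ℕ} where

  Adj-sym : ∀ {u v} → Adj n m u v → Adj n m v u
  Adj-sym (inj₁ e) = inj₂ e
  Adj-sym (inj₂ e) = inj₁ e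

  Adj⇒≢ : ∀ {u v} → Adj n m u v → toℕ u ≢ toℕ v
  Adj⇒≢ (inj₁ (lt , _)) = <⇒≢ lt
  Adj⇒≢ (inj₂ (lt , _)) = >⇒≢ lt

  Adj-irrefl : ∀ {u} → ¬ Adj n m u u
  Adj-irrefl a = Adj⇒≢ a refl

  maximal⇒absorbs : ∀ {A} → MaximalIndependent n m A →
                    ∀ x → (∀ u → u ∈ A → ¬ Adj n m x u) → x ∈ A
  maximal⇒absorbs {A} (indA , maxA) x x-free =
    maxA (A ∪ ⁅ x ⁆) ind (x∈p∪q⁺ ∘ inj₁) (x∈p∪q⁺ (inj₂ (x∈⁅x⁆ x)))
    where
    ind : Independent n m (A ∪ ⁅ x ⁆)
    ind u v u∈ v∈ a with x∈p∪q⁻ A ⁅ x ⁆ u∈ | x∈p∪q⁻ A ⁅ x ⁆ v∈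
    ... | inj₁ uA | inj₁ vA = indA u v uA vA a
    ... | inj₁ uA | inj₂ vx rewrite x∈⁅y⁆⇒x≡y x vx = x-free u uA (Adj-sym a)
    ... | inj₂ ux | inj₁ vA rewrite x∈⁅y⁆⇒x≡y x ux = x-free v vA a
    ... | inj₂ ux | inj₂ vx rewrite x∈⁅y⁆⇒x≡y x ux | x∈⁅y⁆⇒x≡y x vx = Adj-irrefl a

module ColexGraph (n m k r : ℕ) (m≡ : m ≡ suc k C 2 + r) (r≤k : r ≤ k) (k<n : k < n) where

  open ColexEdges m k r m≡ r≤k

  MIS : Subset n → Set
  MIS = MaximalIndependent n m

  data AdjView (u v : Fin n) : Set where
    clique : toℕ u ≤ k → toℕ v ≤ k → AdjView u v
    hubˡ   : toℕ u ≡ suc k → toℕ v < r → AdjView u v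
    hubʳ   : toℕ u < r → toℕ v ≡ suc k → AdjView u v

  adj-view : ∀ {u v} → Adj n m u v → AdjView u v
  adj-view (inj₁ e) with colexEdge-inv e
  ... | u<v , inj₁ v≤k           = clique (<⇒≤ (<-≤-trans u<v v≤k)) v≤k
  ... | _   , inj₂ (v≡hub , u<r) = hubʳ u<r v≡hub
  adj-view (inj₂ e) with colexEdge-inv e
  ... | v<u , inj₁ u≤k           = clique u≤k (<⇒≤ (<-≤-trans v<u u≤k))
  ... | _   , inj₂ (u≡hub , v<r) = hubˡ u≡hub v<r

  clique-adj : ∀ {u v} → toℕ u ≤ k → toℕ v ≤ k → toℕ u ≢ toℕ v → Adj n m u v
  clique-adj {u} {v} u≤k v≤k u≢v with <-cmp (toℕ u) (toℕ v)
  ... | tri< u<v _ _ = inj₁ (colexEdge-clique u<v v≤k)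
  ... | tri≈ _ u≡v _ = ⊥-elim (u≢v u≡v)
  ... | tri> _ _ v<u = inj₂ (colexEdge-clique v<u u≤k)

  hub-adj : ∀ {u v} → toℕ u < r → toℕ v ≡ suc k → Adj n m u v
  hub-adj u<r v≡hub = inj₁ (subst (ColexEdge m _) (sym v≡hub) (colexEdge-hub u<r))

  beyond-clique-neighbour< : ∀ {v w} → suc k ≤ toℕ v → Adj n m v w → toℕ w < toℕ v
  beyond-clique-neighbour< k<v a with adj-view a
  ... | clique v≤k _     = ⊥-elim (<⇒≱ k<v v≤k)
  ... | hubˡ v≡hub w<r   = <-≤-trans w<r (≤-trans (m≤n⇒m≤1+n r≤k) k<v)
  ... | hubʳ v<r _       = ⊥-elim (<⇒≱ (<-≤-trans v<r (m≤n⇒m≤1+n r≤k)) k<v)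

  top : Fin n
  top = fromℕ< k<n

  toℕ-top : toℕ top ≡ k
  toℕ-top = toℕ-fromℕ< k<n

  adj-top : ∀ {w} → Adj n m top w → toℕ w ≤ k
  adj-top a with adj-view a
  ... | clique _ w≤k    = w≤k
  ... | hubˡ top≡hub _  = ⊥-elim (<-irrefl (trans (sym toℕ-top) top≡hub) (n<1+n k))
  ... | hubʳ top<r _    = ⊥-elim (<⇒≱ (subst (_< r) toℕ-top top<r) r≤k)

  clique-vertex-unique : ∀ {A u v} → Independent n m A → u ∈ A → v ∈ A →
                         toℕ u ≤ k → toℕ v ≤ k → u ≡ v
  clique-vertex-unique {u = u} {v} indA uA vA u≤k v≤k with toℕ u ≟ toℕ v
  ... | yes u≡v = toℕ-injective u≡v
  ... | no  u≢v = ⊥-elim (indA u v uA vA (clique-adj u≤k v≤k u≢v))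

  clique-member? : ∀ A → Decidable {A = Fin n} (λ v → v ∈ A × toℕ v ≤ k)
  clique-member? A v = v ∈? A ×-dec (toℕ v ≤? k)

  maximal-meets-clique : ∀ {A} → MIS A → ∃ λ c → c ∈ A × toℕ c ≤ k
  maximal-meets-clique {A} misA with any? (clique-member? A)
  ... | yes found = found
  ... | no  none  = top , topA , ≤-reflexive toℕ-top
    where
    topA : top ∈ A
    topA = maximal⇒absorbs misA top (λ u uA a → none (u , uA , adj-top a))

  data Position (v : Fin n) : Set where
    in-clique : toℕ v ≤ k → Position v
    at-hub    : toℕ v ≡ suc k → Position v
    isolated  : suc k < toℕ v → Position v

  position : ∀ v → Position v
  position v with <-cmp (toℕ v) (suc k)
  ... | tri< v<hub _ _ = in-clique (≤-pred v<hub)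
  ... | tri≈ _ v≡hub _ = at-hub v≡hub
  ... | tri> _ _ hub<v = isolated hub<v

  data Pivot (Z : Subset n) (c : Fin n) : Set where
    least       : c ∈ Z → toℕ c ≤ k → (∀ v → v ∈ Z → toℕ v ≤ k → toℕ c ≤ toℕ v) →
                  Pivot Z c
    clique-free : toℕ c ≡ k → (∀ v → v ∈ Z → k < toℕ v) → Pivot Z c

  pivot-in-clique : ∀ {Z c} → Pivot Z c → toℕ c ≤ k
  pivot-in-clique (least _ c≤k _)     = c≤k
  pivot-in-clique (clique-free c≡k _) = ≤-reflexive c≡k

  pivot-unique : ∀ {Z c d} → Pivot Z c → Pivot Z d → c ≡ d
  pivot-unique (least cZ c≤k c-min) (least dZ d≤k d-min) =
    toℕ-injective (≤-antisym (c-min _ dZ d≤k) (d-min _ cZ c≤k))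
  pivot-unique (least cZ c≤k _) (clique-free _ free) = ⊥-elim (<⇒≱ (free _ cZ) c≤k)
  pivot-unique (clique-free _ free) (least dZ d≤k _) = ⊥-elim (<⇒≱ (free _ dZ) d≤k)
  pivot-unique (clique-free c≡k _) (clique-free d≡k _) = toℕ-injective (trans c≡k (sym d≡k))

  pivot : ∀ Z → ∃ (Pivot Z)
  pivot Z with any? (clique-member? Z)
  ... | no miss = top , clique-free toℕ-top (λ v vZ → ≰⇒> λ v≤k → miss (v , vZ , v≤k))
  ... | yes hit =
    let c , (cZ , c≤k) , c-min = least-witness (clique-member? Z) hit
    in  c , least cZ c≤k (λ v vZ v≤k → c-min v (vZ , v≤k))

  top-replaces-lower : ∀ {A c} → Independent n m A → c ∈ A → toℕ c < k → InSubs n m A c top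
  top-replaces-lower {A} {c} indA cA c<k =
    clique-adj (<⇒≤ c<k) (≤-reflexive toℕ-top) (<⇒≢ (subst (_ <_) (sym toℕ-top) c<k)) , ind
    where
    only-c : ∀ {x} → x ∈ A → toℕ x ≤ k → x ≡ c
    only-c xA x≤k = clique-vertex-unique indA xA cA x≤k (<⇒≤ c<k)
    ind : ∀ x y → ((x ∈ A × x ≢ c) ⊎ x ≡ top) → ((y ∈ A × y ≢ c) ⊎ y ≡ top) → ¬ Adj n m x y
    ind x y (inj₁ (xA , _))   (inj₁ (yA , _))   = indA x y xA yA
    ind x y (inj₂ refl)       (inj₂ refl)       = Adj-irrefl
    ind x y (inj₂ refl)       (inj₁ (yA , y≢c)) a = y≢c (only-c yA (adj-top a))
    ind x y (inj₁ (xA , x≢c)) (inj₂ refl)       a = x≢c (only-c xA (adj-top (Adj-sym a)))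

  lower-clique-inactive : ∀ {A c} → Independent n m A → c ∈ A → toℕ c < k → ¬ InInt n m A c
  lower-clique-inactive indA cA c<k (_ , subs<c) =
    <-asym (subs<c top (top-replaces-lower indA cA c<k)) (subst (_ <_) (sym toℕ-top) c<k)

  interval-clique-min : ∀ {A Z c} → Independent n m A → c ∈ A → toℕ c ≤ k → InInterval n m A Z →
                        ∀ v → v ∈ Z → toℕ v ≤ k → toℕ c ≤ toℕ v
  interval-clique-min {c = c} indA cA c≤k (_ , upper) v vZ v≤k with upper v vZ
  ... | inj₁ vA = ≤-reflexive (cong toℕ (clique-vertex-unique indA cA vA c≤k v≤k))
  ... | inj₂ (_ , a , aA , _ , a<v) =
    <⇒≤ (subst (λ x → toℕ x < toℕ v) a≡c a<v)
    where
    a≡c : a ≡ c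
    a≡c = clique-vertex-unique indA aA cA (<⇒≤ (<-≤-trans a<v v≤k)) c≤k

  interval-pivot : ∀ {A Z c} → Independent n m A → c ∈ A → toℕ c ≤ k → InInterval n m A Z →
                   Pivot Z c
  interval-pivot {Z = Z} {c} indA cA c≤k Z∈I@(lower , _) with m≤n⇒m<n∨m≡n c≤k
  ... | inj₁ c<k =
    least (lower c cA (lower-clique-inactive indA cA c<k)) c≤k (interval-clique-min indA cA c≤k Z∈I)
  ... | inj₂ c≡k with any? (clique-member? Z)
  ...   | yes (v , vZ , v≤k) = least (subst (_∈ Z) v≡c vZ) c≤k (interval-clique-min indA cA c≤k Z∈I)
    where
    v≡c : v ≡ c
    v≡c = toℕ-injective (≤-antisym (subst (_ ≤_) (sym c≡k) v≤k)
                                   (interval-clique-min indA cA c≤k Z∈I v vZ v≤k))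
  ...   | no miss = clique-free c≡k (λ v vZ → ≰⇒> λ v≤k → miss (v , vZ , v≤k))

  maximal-determined-by-clique : ∀ {A B c} → MIS A → MIS B → c ∈ A → c ∈ B → toℕ c ≤ k →
                                 A ⊆ B
  maximal-determined-by-clique {A} {B} {c} (indA , _) misB@(indB , _) cA cB c≤k {v} vA with toℕ v ≤? k
  ... | yes v≤k = subst (_∈ B) (clique-vertex-unique indA cA vA c≤k v≤k) cB
  ... | no  v≰k = maximal⇒absorbs misB v free
    where
    free : ∀ u → u ∈ B → ¬ Adj n m v u
    free u uB a with adj-view a
    ... | clique v≤k _   = v≰k v≤k
    ... | hubʳ v<r _     = v≰k (<⇒≤ (<-≤-trans v<r r≤k))
    ... | hubˡ v≡hub u<r = indA c v cA vA (hub-adj (subst (λ x → toℕ x < r) u≡c u<r) v≡hub)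
      where
      u≡c : u ≡ c
      u≡c = clique-vertex-unique indB uB cB (<⇒≤ (<-≤-trans u<r r≤k)) c≤k

  intervals-disjoint : ∀ A B Z → MIS A → MIS B → InInterval n m A Z → InInterval n m B Z → A ≡ B
  intervals-disjoint A B Z misA misB Z∈A Z∈B with maximal-meets-clique misA | maximal-meets-clique misB
  ... | c , cA , c≤k | d , dB , d≤k
    with pivot-unique (interval-pivot (proj₁ misA) cA c≤k Z∈A) (interval-pivot (proj₁ misB) dB d≤k Z∈B)
  ... | refl = ⊆-antisym (maximal-determined-by-clique misA misB cA dB c≤k)
                         (maximal-determined-by-clique misB misA dB cA c≤k)

  Beyond : Fin n → Fin n → Set
  Beyond c v = suc k < toℕ v ⊎ (toℕ v ≡ suc k × r ≤ toℕ c)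

  Member : Fin n → Fin n → Set
  Member c v = v ≡ c ⊎ Beyond c v

  member? : ∀ c → Decidable (Member c)
  member? c v = (v ≟ᶠ c) ⊎-dec ((suc k <? toℕ v) ⊎-dec ((toℕ v ≟ suc k) ×-dec (r ≤? toℕ c)))

  misOf : Fin n → Subset n
  misOf c = ⟦ member? c ⟧

  beyond-high : ∀ {c v} → Beyond c v → suc k ≤ toℕ v
  beyond-high (inj₁ hub<v)      = <⇒≤ hub<v
  beyond-high (inj₂ (v≡hub , _)) = ≤-reflexive (sym v≡hub)

  beyond-not-adj : ∀ {c v} → toℕ c ≤ k → Beyond c v → ¬ Adj n m v c
  beyond-not-adj c≤k bv a with adj-view a
  ... | clique v≤k _   = <⇒≱ (beyond-high bv) v≤k
  ... | hubʳ _ c≡hub   = <⇒≱ (≤-reflexive (sym c≡hub)) c≤k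
  ... | hubˡ v≡hub c<r with bv
  ...   | inj₁ hub<v      = <-irrefl (sym v≡hub) hub<v
  ...   | inj₂ (_ , r≤c)  = <⇒≱ c<r r≤c

  misOf-independent : ∀ {c} → toℕ c ≤ k → Independent n m (misOf c)
  misOf-independent {c} c≤k u v u∈ v∈ = members (∈⟦⟧⁻ (member? c) u∈) (∈⟦⟧⁻ (member? c) v∈)
    where
    members : ∀ {u v} → Member c u → Member c v → ¬ Adj n m u v
    members (inj₁ refl) (inj₁ refl) = Adj-irrefl
    members (inj₁ refl) (inj₂ bv)   = beyond-not-adj c≤k bv ∘ Adj-sym
    members (inj₂ bu)   (inj₁ refl) = beyond-not-adj c≤k bu
    members (inj₂ bu)   (inj₂ bv) a =
      <-asym (beyond-clique-neighbour< (beyond-high bu) a)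
             (beyond-clique-neighbour< (beyond-high bv) (Adj-sym a))

  misOf-maximal : ∀ {c} → toℕ c ≤ k → ∀ B → Independent n m B → misOf c ⊆ B → B ⊆ misOf c
  misOf-maximal {c} c≤k B indB A⊆B {v} vB = ∈⟦⟧⁺ (member? c) (member (position v))
    where
    cB : c ∈ B
    cB = A⊆B (∈⟦⟧⁺ (member? c) (inj₁ refl))
    member : Position v → Member c v
    member (isolated hub<v) = inj₂ (inj₁ hub<v)
    member (in-clique v≤k) with v ≟ᶠ c
    ... | yes v≡c = inj₁ v≡c
    ... | no  v≢c = ⊥-elim (indB v c vB cB (clique-adj v≤k c≤k (v≢c ∘ toℕ-injective)))
    member (at-hub v≡hub) with r ≤? toℕ c
    ... | yes r≤c = inj₂ (inj₂ (v≡hub , r≤c))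
    ... | no  r≰c = ⊥-elim (indB c v cB vB (hub-adj (≰⇒> r≰c) v≡hub))

  misOf-lower : ∀ {Z c} → Pivot Z c → ∀ v → v ∈ misOf c → ¬ InInt n m (misOf c) v → v ∈ Z
  misOf-lower {c = c} piv v v∈ inactive with ∈⟦⟧⁻ (member? c) v∈
  ... | inj₂ bv = ⊥-elim (inactive (v∈ , λ w (a , _) → beyond-clique-neighbour< (beyond-high bv) a))
  ... | inj₁ refl with piv
  ...   | least cZ _ _       = cZ
  ...   | clique-free c≡k _ = ⊥-elim (inactive (v∈ , λ w (a , _) → below-c a))
    where
    below-c : ∀ {w} → Adj n m c w → toℕ w < toℕ c
    below-c a with toℕ-injective (trans c≡k (sym toℕ-top))
    ... | refl = ≤∧≢⇒< (≤-trans (adj-top a) (≤-reflexive (sym c≡k))) (Adj⇒≢ (Adj-sym a))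

  misOf-upper : ∀ {Z c} → Pivot Z c → ∀ v → v ∈ Z → v ∈ misOf c ⊎ InExt n m (misOf c) v
  misOf-upper {Z} {c} piv v vZ with v ∈? misOf c
  ... | yes v∈ = inj₁ v∈
  ... | no  v∉ = inj₂ (v∉ , c , cA , witness piv (position v))
    where
    cA : c ∈ misOf c
    cA = ∈⟦⟧⁺ (member? c) (inj₁ refl)
    c≤k : toℕ c ≤ k
    c≤k = pivot-in-clique piv
    witness : Pivot Z c → Position v → Adj n m v c × toℕ c < toℕ v
    witness _ (isolated hub<v) = ⊥-elim (v∉ (∈⟦⟧⁺ (member? c) (inj₂ (inj₁ hub<v))))
    witness (clique-free _ free) (in-clique v≤k) = ⊥-elim (<⇒≱ (free v vZ) v≤k)
    witness (least _ _ c-min)    (in-clique v≤k) =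
      clique-adj v≤k c≤k v≢c , ≤∧≢⇒< (c-min v vZ v≤k) (v≢c ∘ sym)
      where
      v≢c : toℕ v ≢ toℕ c
      v≢c v≡c = v∉ (∈⟦⟧⁺ (member? c) (inj₁ (toℕ-injective v≡c)))
    witness _ (at-hub v≡hub) with r ≤? toℕ c
    ... | yes r≤c = ⊥-elim (v∉ (∈⟦⟧⁺ (member? c) (inj₂ (inj₂ (v≡hub , r≤c)))))
    ... | no  r≰c = Adj-sym (hub-adj (≰⇒> r≰c) v≡hub) , subst (toℕ c <_) (sym v≡hub) (s≤s c≤k)

  intervals-cover : ∀ Z → ∃ λ A → MIS A × InInterval n m A Z
  intervals-cover Z with pivot Z
  ... | c , piv =
    misOf c , (misOf-independent c≤k , misOf-maximal c≤k) , misOf-lower piv , misOf-upper piv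
    where
    c≤k : toℕ c ≤ k
    c≤k = pivot-in-clique piv

  intervals-partition : IntervalsPartition n m
  intervals-partition = intervals-cover , intervals-disjoint

clique-top<n : ∀ {n m k r} → 1 ≤ n → m ≡ suc k C 2 + r → m ≤ n C 2 → k < n
clique-top<n {n} {m} {k} {r} 0<n m≡ m≤ = ≤-pred (C₂-cancel-< (begin-strict
  suc k C 2     ≤⟨ m≤m+n (suc k C 2) r ⟩
  suc k C 2 + r ≡⟨ m≡ ⟨
  m             ≤⟨ m≤ ⟩
  n C 2         ≡⟨ +-identityʳ (n C 2) ⟨
  n C 2 + 0     <⟨ C₂-+-< 0<n ⟩
  suc n C 2     ∎))
  where open ≤-Reasoning

theorem13 : (n m : ℕ) → 2 ≤ n → 1 ≤ m → m ≤ n C 2 → IntervalsPartition n m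
theorem13 n m 2≤n _ m≤ with colex-decomposition m
... | k , r , r≤k , m≡ =
  ColexGraph.intervals-partition n m k r m≡ r≤k (clique-top<n (≤-trans (s≤s z≤n) 2≤n) m≡ m≤)
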